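{- Let $G$ be a bipartite graph with vertex classes $V^+$ and $V^-$, let $m\in\mathbb{N}$ and let $\kappa:V(G)\to\{1,\dots,m\}$. Then among all list assignments $L$ for $G$ such that $|L(v)|=\kappa(v)$ and $\max L(v)\le m$ for every $v\in V(G)$, the number $\|L\|$ is maximized by the list assignment $L_0$ with $L_0(v)=\{1,\dots,\kappa(v)\}$ for $v\in V^+$ and $L_0(v)=\{m-\kappa(v)+1,\dots,m\}$ for $v\in V^-$.
   Context: A list assignment for $G$ assigns to each vertex $v$ a set $L(v)$ of positive integers; an $L$-colouring is a proper colouring $c$ of $G$ (adjacent vertices get different colours) with $c(v)\in L(v)$ for all $v$, and $\|L\|$ denotes the number of $L$-colourings of $G$. -}

module Defs where

open import Data.Nat using (ℕ; zero; suc; _<_; _≤_; _∸_)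
open import Data.Nat.Properties using (_<?_; _≤?_)
open import Data.Bool using (Bool; true; false; _∧_; if_then_else_)
open import Data.Fin using (Fin; toℕ)
open import Data.Fin.Subset using (Subset; _∈_; ∣_∣)
open import Data.Fin.Subset.Properties using (_∈?_)
open import Data.Fin.Properties using (all?; _≟_)
open import Data.Vec using (Vec; []; _∷_; tabulate; lookup)
open import Data.List using (List; []; _∷_; concatMap; map; filter; length; allFin)
open import Data.Product using (_×_)
open import Relation.Nullary using (¬_; Dec)
open import Relation.Nullary.Decidable using (_×-dec_; ¬?; _→-dec_)
open import Relation.Binary.PropositionalEquality using (_≡_)
open import Data.Bool.Properties using () renaming (_≟_ to _≟ᵇ_)

-- Colours: a list assignment with max L(v) ≤ m is a map v ↦ L v ⊆ {1,…,m};
-- we encode colour j ∈ {1,…,m} by the element (j-1) of Fin m, so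
-- L v : Subset m.
ListAssignment : ℕ → ℕ → Set
ListAssignment n m = Fin n → Subset m

allVecs : (n m : ℕ) → List (Vec (Fin m) n)
allVecs zero    m = [] ∷ []
allVecs (suc n) m = concatMap (λ x → map (x ∷_) (allVecs n m)) (allFin m)

IsLColouring : ∀ {n m} → (Fin n → Fin n → Bool) → ListAssignment n m → Vec (Fin m) n → Set
IsLColouring {n} E L c =
  (∀ v → lookup c v ∈ L v) ×
  (∀ u v → E u v ≡ true → ¬ (lookup c u ≡ lookup c v))

isLColouring? : ∀ {n m} (E : Fin n → Fin n → Bool) (L : ListAssignment n m)
                (c : Vec (Fin m) n) → Dec (IsLColouring E L c)
isLColouring? E L c =
  all? (λ v → lookup c v ∈? L v) ×-dec
  all? (λ u → all? (λ v → (E u v ≟ᵇ true) →-dec ¬? (lookup c u ≟ lookup c v)))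

numColourings : ∀ {n m} → (Fin n → Fin n → Bool) → ListAssignment n m → ℕ
numColourings {n} {m} E L = length (filter (isLColouring? E L) (allVecs n m))

-- L₀(v) = {1,…,κ v} if side v = true (v ∈ V⁺),
-- L₀(v) = {m-κ v+1,…,m} if side v = false (v ∈ V⁻).
L₀ : ∀ {n} (m : ℕ) → (Fin n → Bool) → (Fin n → ℕ) → ListAssignment n m
L₀ m side κ v = tabulate λ i →
  if side v then Relation.Nullary.Decidable.⌊ toℕ i <? κ v ⌋
            else Relation.Nullary.Decidable.⌊ m ∸ κ v ≤? toℕ i ⌋

-- Fix consecutive colours i and i + 1. Compressing L replaces, in every list, i + 1 by i
-- on V⁺ and i by i + 1 on V⁻ whenever the new colour is absent. This does not decrease ‖L‖:
-- map an L-colouring to the colouring that gives every vertex of R its preferred colour,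
-- where R is the union of the {i, i + 1}-Kempe chains through the vertices whose colour
-- left their list. In a proper colouring R carries only the non-preferred colour, and the
-- regions of two colourings with the same image coincide, so the map is injective. Every
-- effective compression lowers the total distance of the lists from their preferred ends,
-- and a list fixed by all compressions is an initial (on V⁺) or final (on V⁻) segment of
-- the colours, hence contained in L₀.

module Submission where

open import Defs
open import Data.Nat using (ℕ; zero; suc; _≤_; _<_; _+_; _∸_; z≤n; s≤s; s≤s⁻¹)
open import Data.Nat.Properties
  using (_<?_; _≤?_; +-0-monoid; n<1+n; 1+n≢n; +-comm; +-monoʳ-<; +-monoʳ-≤;
         +-mono-≤; +-mono-<-≤; +-mono-≤-<; ≤-refl; ≤-reflexive; ≤-trans; <⇒≤; m≤n+o⇒m∸n≤o; m∸[m∸n]≡n)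
open import Data.Nat.Induction using (<-wellFounded)
open import Algebra.Properties.Monoid.Sum +-0-monoid using (sum)
open import Data.Bool using (Bool; true; false; _∧_; _∨_; if_then_else_)
open import Data.Bool.Properties using () renaming (_≟_ to _≟ᵇ_)
open import Data.Fin using (Fin; zero; suc; toℕ; inject₁)
open import Data.Fin.Properties using (_≟_; all?; any?; toℕ-inject₁)
open import Data.Fin.Subset using (Subset; _∈_; _∉_; _⊆_; ∣_∣)
open import Data.Fin.Subset.Properties using (_∈?_; anySubset?; ∣p∣≤∣x∷p∣)
open import Data.Vec using (Vec; []; _∷_; lookup; tabulate)
open import Data.Vec.Base using (_[_]=_)
import Data.Vec.Properties as Vec
open import Data.List using (List; []; _∷_; _++_; length; map; filter)
open import Data.List.Properties using (length-++-sucʳ)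
open import Data.List.Membership.Propositional using () renaming (_∈_ to _∈ˡ_)
open import Data.List.Membership.Propositional.Properties
  using (∈-∃++; ∈-++⁻; ∈-++⁺ˡ; ∈-++⁺ʳ; ∈-map⁺; ∈-map⁻; ∈-concat⁺′; ∈-allFin; ∈-filter⁺; ∈-filter⁻)
open import Data.List.Relation.Unary.Any using (here; there)
open import Data.List.Relation.Unary.All as All using ([])
import Data.List.Relation.Unary.All.Properties as All
import Data.List.Relation.Unary.AllPairs as AllPairs
import Data.List.Relation.Unary.AllPairs.Properties as AllPairs
open import Data.List.Relation.Unary.Unique.Propositional using (Unique; []; _∷_)
import Data.List.Relation.Unary.Unique.Propositional.Properties as Unique
open import Data.List.Relation.Binary.Disjoint.Propositional using (Disjoint)
open import Data.Product using (_×_; _,_; ∃; proj₁; proj₂)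
open import Data.Sum using (_⊎_; inj₁; inj₂)
open import Function using (_∘_; id; mk⇔)
open import Induction.WellFounded using (Acc; acc)
open import Level using (0ℓ)
open import Relation.Nullary using (¬_; Dec; yes; no; does; contradiction)
open import Relation.Nullary.Decidable
  using (⌊_⌋; _×-dec_; _⊎-dec_; _→-dec_; ¬?; dec-true; does-⇔; isYes≗does; decidable-stable)
open import Relation.Unary using (Pred; Decidable)
open import Relation.Binary.PropositionalEquality
  using (_≡_; _≢_; refl; sym; trans; cong; subst; module ≡-Reasoning)

open ≡-Reasoning
open _[_]=_

module _ {A B : Set} where

  ∈-++-skip : ∀ {x y : B} us vs → y ∈ˡ us ++ x ∷ vs → y ≢ x → y ∈ˡ us ++ vs
  ∈-++-skip us vs y∈ y≢x with ∈-++⁻ us y∈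
  ... | inj₁ y∈us         = ∈-++⁺ˡ y∈us
  ... | inj₂ (here y≡x)   = contradiction y≡x y≢x
  ... | inj₂ (there y∈vs) = ∈-++⁺ʳ us y∈vs

  injection⇒length-≤ : ∀ {xs : List A} {ys : List B} (f : A → B) → Unique xs →
                       (∀ {x y} → x ∈ˡ xs → y ∈ˡ xs → f x ≡ f y → x ≡ y) →
                       (∀ {x} → x ∈ˡ xs → f x ∈ˡ ys) → length xs ≤ length ys
  injection⇒length-≤ {[]}     f _            _   _    = z≤n
  injection⇒length-≤ {x ∷ xs} f (x∉xs ∷ xs!) inj maps with ∈-∃++ (maps (here refl))
  ... | us , vs , refl = subst (suc (length xs) ≤_) (sym (length-++-sucʳ us (f x) vs))
    (s≤s (injection⇒length-≤ f xs! (λ p q → inj (there p) (there q)) maps′))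
    where
    maps′ : ∀ {y} → y ∈ˡ xs → f y ∈ˡ us ++ vs
    maps′ y∈ = ∈-++-skip us vs (maps (there y∈))
      (λ fy≡fx → All.lookup x∉xs y∈ (sym (inj (there y∈) (here refl) fy≡fx)))

allVecs-complete : ∀ n m (c : Vec (Fin m) n) → c ∈ˡ allVecs n m
allVecs-complete zero    m []      = here refl
allVecs-complete (suc n) m (x ∷ c) =
  ∈-concat⁺′ (∈-map⁺ (x ∷_) (allVecs-complete n m c)) (∈-map⁺ _ (∈-allFin x))

allVecs-unique : ∀ n m → Unique (allVecs n m)
allVecs-unique zero    m = [] ∷ []
allVecs-unique (suc n) m =
  Unique.concat⁺ (All.map⁺ (All.tabulate⁺ λ _ → Unique.map⁺ Vec.∷-injectiveʳ (allVecs-unique n m)))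
                 (AllPairs.map⁺ (AllPairs.map disjoint (Unique.allFin⁺ m)))
  where
  disjoint : ∀ {x y} → x ≢ y → Disjoint (map (x ∷_) (allVecs n m)) (map (y ∷_) (allVecs n m))
  disjoint x≢y (p , q) with ∈-map⁻ _ p | ∈-map⁻ _ q
  ... | _ , _ , refl | _ , _ , x∷c≡y∷d = x≢y (Vec.∷-injectiveˡ x∷c≡y∷d)

module _ {A B : Set} {P : Pred A 0ℓ} {Q : Pred B 0ℓ} (P? : Decidable P) (Q? : Decidable Q) where

  count-injection : ∀ {xs : List A} {ys : List B} (f : A → B) → Unique xs → (∀ {x} → x ∈ˡ ys) →
                    (∀ {x} → P x → Q (f x)) → (∀ {x y} → P x → P y → f x ≡ f y → x ≡ y) →
                    length (filter P? xs) ≤ length (filter Q? ys)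
  count-injection {xs} {ys} f xs! complete PQ inj =
    injection⇒length-≤ f (Unique.filter⁺ P? xs!) (λ p q → inj (holds p) (holds q))
      (λ p → ∈-filter⁺ Q? {xs = ys} complete (PQ (holds p)))
    where
    holds : ∀ {x} → x ∈ˡ filter P? xs → P x
    holds p = proj₂ (∈-filter⁻ P? {xs = xs} p)

numColourings-injection : ∀ {n m} (E : Fin n → Fin n → Bool) (L L′ : ListAssignment n m)
  (f : Vec (Fin m) n → Vec (Fin m) n) →
  (∀ {c} → IsLColouring E L c → IsLColouring E L′ (f c)) →
  (∀ {c d} → IsLColouring E L c → IsLColouring E L d → f c ≡ f d → c ≡ d) →
  numColourings E L ≤ numColourings E L′
numColourings-injection {n} {m} E L L′ f =
  count-injection (isLColouring? E L) (isLColouring? E L′) f (allVecs-unique n m) (allVecs-complete n m _)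

numColourings-mono : ∀ {n m} (E : Fin n → Fin n → Bool) {L L′ : ListAssignment n m} →
                     (∀ v → L v ⊆ L′ v) → numColourings E L ≤ numColourings E L′
numColourings-mono E {L} {L′} L⊆L′ = numColourings-injection E L L′ id
  (λ (c∈L , proper) → (λ v → L⊆L′ v (c∈L v)) , proper) (λ _ _ c≡d → c≡d)

toSubset : ∀ {n} {P : Pred (Fin n) 0ℓ} → Decidable P → Subset n
toSubset P? = tabulate (does ∘ P?)

∈-toSubset⁺ : ∀ {n} {P : Pred (Fin n) 0ℓ} (P? : Decidable P) {v} → P v → v ∈ toSubset P?
∈-toSubset⁺ P? {v} p = Vec.lookup⇒[]= v _ (trans (Vec.lookup∘tabulate _ v) (dec-true (P? v) p))

∈-toSubset⁻ : ∀ {n} {P : Pred (Fin n) 0ℓ} (P? : Decidable P) {v} → v ∈ toSubset P? → P v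
∈-toSubset⁻ P? {v} v∈ with P? v | trans (sym (Vec.lookup∘tabulate (does ∘ P?) v)) (Vec.[]=⇒lookup v∈)
... | yes p | _  = p
... | no _  | ()

module KempeRecolouring {n m : ℕ} (E : Fin n → Fin n → Bool) (E-sym : ∀ u v → E u v ≡ E v u)
  (side : Fin n → Bool) (bipartite : ∀ u v → E u v ≡ true → side u ≢ side v)
  {a b : Fin m} (a≢b : a ≢ b) where

  preferred other : Fin n → Fin m
  preferred v = if side v then a else b
  other     v = if side v then b else a

  InPair : Fin m → Set
  InPair x = x ≡ a ⊎ x ≡ b

  inPair? : Decidable InPair
  inPair? x = (x ≟ a) ⊎-dec (x ≟ b)

  preferred-inPair : ∀ v → InPair (preferred v)
  preferred-inPair v with side v
  ... | true  = inj₁ refl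
  ... | false = inj₂ refl

  other-inPair : ∀ v → InPair (other v)
  other-inPair v with side v
  ... | true  = inj₂ refl
  ... | false = inj₁ refl

  inPair⇒preferred⊎other : ∀ v {x} → InPair x → x ≡ preferred v ⊎ x ≡ other v
  inPair⇒preferred⊎other v x∈ with side v | x∈
  ... | true  | inj₁ x≡a = inj₁ x≡a
  ... | true  | inj₂ x≡b = inj₂ x≡b
  ... | false | inj₁ x≡a = inj₂ x≡a
  ... | false | inj₂ x≡b = inj₁ x≡b

  preferred≡other-across : ∀ {u w} → E u w ≡ true → preferred w ≡ other u
  preferred≡other-across {u} {w} uw with side u | side w | bipartite u w uw
  ... | true  | true  | ≢ = contradiction refl ≢
  ... | true  | false | _ = refl
  ... | false | true  | _ = refl
  ... | false | false | ≢ = contradiction refl ≢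

  preferred≢-across : ∀ {u w} → E u w ≡ true → preferred u ≢ preferred w
  preferred≢-across {u} {w} uw with side u | side w | bipartite u w uw
  ... | true  | true  | ≢ = contradiction refl ≢
  ... | true  | false | _ = a≢b
  ... | false | true  | _ = a≢b ∘ sym
  ... | false | false | ≢ = contradiction refl ≢

  module _ {L L′ : ListAssignment n m}
    (others-kept : ∀ v {x} → x ≢ a → x ≢ b → x ∈ L v → x ∈ L′ v)
    (preferred-kept : ∀ v → preferred v ∈ L v → preferred v ∈ L′ v)
    (other-moved : ∀ v → other v ∈ L v → preferred v ∈ L′ v)
    (both-kept : ∀ v → preferred v ∈ L v → other v ∈ L v → other v ∈ L′ v) where

    Colouring : Set
    Colouring = Vec (Fin m) n

    Bad : Colouring → Fin n → Set
    Bad c v = InPair (lookup c v) × lookup c v ∉ L′ v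

    Closed : Colouring → Subset n → Set
    Closed c Z = ∀ u w → u ∈ Z → E u w ≡ true → InPair (lookup c w) → w ∈ Z

    ContainsBad : Colouring → Subset n → Set
    ContainsBad c Z = ∀ u → Bad c u → u ∈ Z

    -- The union of the {a, b}-Kempe chains of c through bad vertices: the least
    -- closed set containing them, phrased so that membership is decidable.
    InRegion : Colouring → Fin n → Set
    InRegion c v = ¬ ∃ λ Z → Closed c Z × ContainsBad c Z × v ∉ Z

    inRegion? : ∀ c → Decidable (InRegion c)
    inRegion? c v = ¬? (anySubset? λ Z → closed? Z ×-dec containsBad? Z ×-dec ¬? (v ∈? Z))
      where
      closed? : Decidable (Closed c)
      closed? Z = all? λ u → all? λ w →
        (u ∈? Z) →-dec (E u w ≟ᵇ true) →-dec inPair? (lookup c w) →-dec (w ∈? Z)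
      containsBad? : Decidable (ContainsBad c)
      containsBad? Z = all? λ u → (inPair? (lookup c u) ×-dec ¬? (lookup c u ∈? L′ u)) →-dec (u ∈? Z)

    region-least : ∀ c {v} → InRegion c v → ∀ Z → Closed c Z → ContainsBad c Z → v ∈ Z
    region-least c {v} v∈R Z closed bad⊆Z with v ∈? Z
    ... | yes v∈Z = v∈Z
    ... | no  v∉Z = contradiction (Z , closed , bad⊆Z , v∉Z) v∈R

    bad⇒inRegion : ∀ c {v} → Bad c v → InRegion c v
    bad⇒inRegion c bad (Z , _ , bad⊆Z , v∉Z) = v∉Z (bad⊆Z _ bad)

    region-closed : ∀ c {u w} → InRegion c u → E u w ≡ true → InPair (lookup c w) → InRegion c w
    region-closed c u∈R uw w∈ab (Z , closed , bad⊆Z , w∉Z) =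
      w∉Z (closed _ _ (region-least c u∈R Z closed bad⊆Z) uw w∈ab)

    recolour : Colouring → Fin n → Fin m
    recolour c v with inRegion? c v
    ... | yes _ = preferred v
    ... | no  _ = lookup c v

    recolour-inside : ∀ c {v} → InRegion c v → recolour c v ≡ preferred v
    recolour-inside c {v} v∈R with inRegion? c v
    ... | yes _   = refl
    ... | no  v∉R = contradiction v∈R v∉R

    recolour-outside : ∀ c {v} → ¬ InRegion c v → recolour c v ≡ lookup c v
    recolour-outside c {v} v∉R with inRegion? c v
    ... | yes v∈R = contradiction v∈R v∉R
    ... | no  _   = refl

    region-boundary : ∀ c {u w} → E u w ≡ true → InRegion c u → ¬ InRegion c w →
                      preferred u ≢ lookup c w
    region-boundary c uw u∈R w∉R pu≡cw =
      w∉R (region-closed c u∈R uw (subst InPair pu≡cw (preferred-inPair _)))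

    inPair-recolour : ∀ c v → InPair (lookup c v) → InPair (recolour c v)
    inPair-recolour c v c∈ab with inRegion? c v
    ... | yes _ = preferred-inPair v
    ... | no  _ = c∈ab

    module _ (c : Colouring) (c-ok : IsLColouring E L c) where

      bad⇒other : ∀ {v} → Bad c v → lookup c v ≡ other v
      bad⇒other {v} (c∈ab , c∉L′) with inPair⇒preferred⊎other v c∈ab
      ... | inj₂ c≡other     = c≡other
      ... | inj₁ c≡preferred = contradiction
        (subst (_∈ L′ v) (sym c≡preferred) (preferred-kept v (subst (_∈ L v) c≡preferred (proj₁ c-ok v))))
        c∉L′

      bad⇒preferred∉L : ∀ {v} → Bad c v → preferred v ∉ L v
      bad⇒preferred∉L {v} bad preferred∈L = proj₂ bad
        (subst (_∈ L′ v) (sym c≡other) (both-kept v preferred∈L (subst (_∈ L v) c≡other (proj₁ c-ok v))))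
        where c≡other = bad⇒other bad

      -- In a proper colouring the other-coloured vertices form a closed set, since
      -- across an edge the preferred colour of one side is the other colour of the other.
      inRegion⇒other : ∀ {v} → InRegion c v → lookup c v ≡ other v
      inRegion⇒other v∈R = ∈-toSubset⁻ other? (region-least c v∈R (toSubset other?) closed bad⊆O)
        where
        other? : Decidable (λ v → lookup c v ≡ other v)
        other? v = lookup c v ≟ other v
        closed : Closed c (toSubset other?)
        closed u w u∈O uw w∈ab with inPair⇒preferred⊎other w w∈ab
        ... | inj₂ w-other     = ∈-toSubset⁺ other? w-other
        ... | inj₁ w-preferred = contradiction
          (trans (∈-toSubset⁻ other? u∈O) (sym (trans w-preferred (preferred≡other-across uw))))
          (proj₂ c-ok u w uw)
        bad⊆O : ContainsBad c (toSubset other?)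
        bad⊆O u bad = ∈-toSubset⁺ other? (bad⇒other bad)

      inPair-recolour⁻ : ∀ v → InPair (recolour c v) → InPair (lookup c v)
      inPair-recolour⁻ v r∈ab with inRegion? c v
      ... | yes v∈R = subst InPair (sym (inRegion⇒other v∈R)) (other-inPair v)
      ... | no  _   = r∈ab

      recolour-∈L′ : ∀ v → recolour c v ∈ L′ v
      recolour-∈L′ v with inRegion? c v
      ... | yes v∈R = other-moved v (subst (_∈ L v) (inRegion⇒other v∈R) (proj₁ c-ok v))
      ... | no  v∉R with lookup c v ∈? L′ v
      ...   | yes c∈L′ = c∈L′
      ...   | no  c∉L′ with inPair? (lookup c v)
      ...     | yes c∈ab = contradiction (bad⇒inRegion c (c∈ab , c∉L′)) v∉R
      ...     | no  c∉ab = others-kept v (c∉ab ∘ inj₁) (c∉ab ∘ inj₂) (proj₁ c-ok v)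

      recolour-proper : ∀ u w → E u w ≡ true → recolour c u ≢ recolour c w
      recolour-proper u w uw with inRegion? c u | inRegion? c w
      ... | yes _   | yes _   = preferred≢-across uw
      ... | no  _   | no  _   = proj₂ c-ok u w uw
      ... | yes u∈R | no  w∉R = region-boundary c uw u∈R w∉R
      ... | no  u∉R | yes w∈R = region-boundary c (trans (E-sym w u) uw) w∈R u∉R ∘ sym

      recoloured-valid : IsLColouring E L′ (tabulate (recolour c))
      recoloured-valid =
        (λ v → subst (_∈ L′ v) (sym (Vec.lookup∘tabulate _ v)) (recolour-∈L′ v)) ,
        (λ u w uw r≡r → recolour-proper u w uw
          (trans (sym (Vec.lookup∘tabulate _ u)) (trans r≡r (Vec.lookup∘tabulate _ w))))

    region-⊆ : ∀ c d → IsLColouring E L c → IsLColouring E L d → (∀ v → recolour c v ≡ recolour d v) →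
               ∀ {v} → InRegion c v → InRegion d v
    region-⊆ c d c-ok d-ok same v∈R =
      ∈-toSubset⁻ (inRegion? d) (region-least c v∈R (toSubset (inRegion? d)) closed bad⊆)
      where
      closed : Closed c (toSubset (inRegion? d))
      closed u w u∈ uw cw∈ab = ∈-toSubset⁺ (inRegion? d) (region-closed d (∈-toSubset⁻ (inRegion? d) u∈) uw
        (inPair-recolour⁻ d d-ok w (subst InPair (same w) (inPair-recolour c w cw∈ab))))
      -- Outside d's region, d would give a bad vertex of c its preferred colour,
      -- which is not in its list.
      bad⊆ : ContainsBad c (toSubset (inRegion? d))
      bad⊆ u bad = ∈-toSubset⁺ (inRegion? d) (decidable-stable (inRegion? d u) λ u∉R →
        bad⇒preferred∉L c c-ok bad (subst (_∈ L u) (d≡preferred u∉R) (proj₁ d-ok u)))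
        where
        d≡preferred : ¬ InRegion d u → lookup d u ≡ preferred u
        d≡preferred u∉R = begin
          lookup d u   ≡⟨ recolour-outside d u∉R ⟨
          recolour d u ≡⟨ same u ⟨
          recolour c u ≡⟨ recolour-inside c (bad⇒inRegion c bad) ⟩
          preferred u  ∎

    recolour-injective : ∀ {c d} → IsLColouring E L c → IsLColouring E L d →
                         (∀ v → recolour c v ≡ recolour d v) → c ≡ d
    recolour-injective {c} {d} c-ok d-ok same = begin
      c                   ≡⟨ Vec.tabulate∘lookup c ⟨
      tabulate (lookup c) ≡⟨ Vec.tabulate-cong same-colour ⟩
      tabulate (lookup d) ≡⟨ Vec.tabulate∘lookup d ⟩
      d                   ∎
      where
      same-colour : ∀ v → lookup c v ≡ lookup d v
      same-colour v with inRegion? c v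
      ... | yes v∈R = trans (inRegion⇒other c c-ok v∈R)
                            (sym (inRegion⇒other d d-ok (region-⊆ c d c-ok d-ok same v∈R)))
      ... | no  v∉R = begin
        lookup c v   ≡⟨ recolour-outside c v∉R ⟨
        recolour c v ≡⟨ same v ⟩
        recolour d v ≡⟨ recolour-outside d (v∉R ∘ region-⊆ d c d-ok c-ok (sym ∘ same)) ⟩
        lookup d v   ∎

    numColourings-≤ : numColourings E L ≤ numColourings E L′
    numColourings-≤ = numColourings-injection E L L′ (tabulate ∘ recolour) (recoloured-valid _)
      λ c-ok d-ok eq → recolour-injective c-ok d-ok λ v →
        trans (sym (Vec.lookup∘tabulate _ v)) (trans (cong (λ r → lookup r v) eq) (Vec.lookup∘tabulate _ v))

-- compress true i replaces colour i + 1 by i if i is missing; compress false i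
-- replaces colour i by i + 1 if i + 1 is missing.
compress : ∀ {k} → Bool → Fin k → Subset (suc k) → Subset (suc k)
compress d     (suc i) (x ∷ S)     = x ∷ compress d i S
compress true  zero    (x ∷ y ∷ S) = (x ∨ y) ∷ (x ∧ y) ∷ S
compress false zero    (x ∷ y ∷ S) = (x ∧ y) ∷ (x ∨ y) ∷ S

target source : ∀ {k} → Bool → Fin k → Fin (suc k)
target d i = if d then inject₁ i else suc i
source d i = if d then suc i else inject₁ i

compress-keeps-others : ∀ {k} d (i : Fin k) {S j} → j ≢ inject₁ i → j ≢ suc i →
                        j ∈ S → j ∈ compress d i S
compress-keeps-others d     (suc i) {_ ∷ _}     _   _     here               = here
compress-keeps-others d     (suc i) {_ ∷ _}     j≢i j≢1+i (there j∈)         =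
  there (compress-keeps-others d i (j≢i ∘ cong suc) (j≢1+i ∘ cong suc) j∈)
compress-keeps-others d     zero    {_ ∷ _ ∷ _} j≢i _     here               = contradiction refl j≢i
compress-keeps-others d     zero    {_ ∷ _ ∷ _} _   j≢1+i (there here)       = contradiction refl j≢1+i
compress-keeps-others true  zero    {_ ∷ _ ∷ _} _   _     (there (there j∈)) = there (there j∈)
compress-keeps-others false zero    {_ ∷ _ ∷ _} _   _     (there (there j∈)) = there (there j∈)

compress-keeps-target : ∀ {k} d (i : Fin k) {S} → target d i ∈ S → target d i ∈ compress d i S
compress-keeps-target true  (suc i) {_ ∷ _}         (there t∈)   = there (compress-keeps-target true i t∈)
compress-keeps-target false (suc i) {_ ∷ _}         (there t∈)   = there (compress-keeps-target false i t∈)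
compress-keeps-target true  zero    {_ ∷ _ ∷ _}     here         = here
compress-keeps-target false zero    {true  ∷ _ ∷ _} (there here) = there here
compress-keeps-target false zero    {false ∷ _ ∷ _} (there here) = there here

compress-moves-source : ∀ {k} d (i : Fin k) {S} → source d i ∈ S → target d i ∈ compress d i S
compress-moves-source true  (suc i) {_ ∷ _}         (there s∈)   = there (compress-moves-source true i s∈)
compress-moves-source false (suc i) {_ ∷ _}         (there s∈)   = there (compress-moves-source false i s∈)
compress-moves-source true  zero    {true  ∷ _ ∷ _} (there here) = here
compress-moves-source true  zero    {false ∷ _ ∷ _} (there here) = here
compress-moves-source false zero    {_ ∷ _ ∷ _}     here         = there here

compress-keeps-both : ∀ {k} d (i : Fin k) {S} → target d i ∈ S → source d i ∈ S →
                      source d i ∈ compress d i S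
compress-keeps-both true  (suc i) {_ ∷ _} (there t∈) (there s∈) = there (compress-keeps-both true i t∈ s∈)
compress-keeps-both false (suc i) {_ ∷ _} (there t∈) (there s∈) = there (compress-keeps-both false i t∈ s∈)
compress-keeps-both true  zero {_ ∷ _ ∷ _} here         (there here) = there here
compress-keeps-both false zero {_ ∷ _ ∷ _} (there here) here         = here

∣compress∣ : ∀ {k} d (i : Fin k) S → ∣ compress d i S ∣ ≡ ∣ S ∣
∣compress∣ d     (suc i) (true  ∷ S)         = cong suc (∣compress∣ d i S)
∣compress∣ d     (suc i) (false ∷ S)         = ∣compress∣ d i S
∣compress∣ true  zero    (true  ∷ true  ∷ S) = refl
∣compress∣ true  zero    (true  ∷ false ∷ S) = refl
∣compress∣ true  zero    (false ∷ true  ∷ S) = refl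
∣compress∣ true  zero    (false ∷ false ∷ S) = refl
∣compress∣ false zero    (true  ∷ true  ∷ S) = refl
∣compress∣ false zero    (true  ∷ false ∷ S) = refl
∣compress∣ false zero    (false ∷ true  ∷ S) = refl
∣compress∣ false zero    (false ∷ false ∷ S) = refl

-- The sum, over the members of S, of their distance from the end that compress d
-- moves towards: position 0 if d, position k if not.
displacement : ∀ {k} → Bool → Subset k → ℕ
displacement         true  []      = 0
displacement         true  (x ∷ S) = ∣ S ∣ + displacement true S
displacement         false []      = 0
displacement {suc k} false (x ∷ S) = (if x then k else 0) + displacement false S

compress-fixes-or-decreases : ∀ {k} d (i : Fin k) S →
  compress d i S ≡ S ⊎ displacement d (compress d i S) < displacement d S
compress-fixes-or-decreases d (suc i) (x ∷ S) with compress-fixes-or-decreases d i S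
... | inj₁ fixed = inj₁ (cong (x ∷_) fixed)
compress-fixes-or-decreases true (suc i) (x ∷ S) | inj₂ smaller rewrite ∣compress∣ true i S =
  inj₂ (+-monoʳ-< ∣ S ∣ smaller)
compress-fixes-or-decreases {suc k} false (suc i) (x ∷ S) | inj₂ smaller =
  inj₂ (+-monoʳ-< (if x then suc k else 0) smaller)
compress-fixes-or-decreases true  zero (true  ∷ y     ∷ S) = inj₁ refl
compress-fixes-or-decreases true  zero (false ∷ true  ∷ S) = inj₂ (n<1+n _)
compress-fixes-or-decreases true  zero (false ∷ false ∷ S) = inj₁ refl
compress-fixes-or-decreases false zero (true  ∷ true  ∷ S) = inj₁ refl
compress-fixes-or-decreases false zero (true  ∷ false ∷ S) = inj₂ (n<1+n _)
compress-fixes-or-decreases false zero (false ∷ y     ∷ S) = inj₁ refl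

Compressed : ∀ {k} → Bool → Subset (suc k) → Set
Compressed d S = ∀ i → compress d i S ≡ S

compressed-tail : ∀ {k d x} {S : Subset (suc k)} → Compressed d (x ∷ S) → Compressed d S
compressed-tail compressed i = Vec.∷-injectiveʳ (compressed (suc i))

zero∈compressed : ∀ {k j} {S : Subset (suc k)} → Compressed true S → j ∈ S → zero ∈ S
zero∈compressed                     _          here       = here
zero∈compressed {S = true ∷ _}      _          (there _)  = here
zero∈compressed {S = false ∷ _ ∷ _} compressed (there j∈)
  with zero∈compressed (compressed-tail compressed) j∈
... | here with compressed zero
...   | ()

∈compressed⇒< : ∀ {k j} {S : Subset (suc k)} → Compressed true S → j ∈ S → toℕ j < ∣ S ∣
∈compressed⇒< {S = true ∷ _}  _          here       = s≤s z≤n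
∈compressed⇒< {S = _ ∷ _ ∷ _} compressed (there j∈) with zero∈compressed compressed (there j∈)
... | here = s≤s (∈compressed⇒< (compressed-tail compressed) j∈)

compressed-full : ∀ {k} {S : Subset k} → Compressed false (true ∷ S) → k ≤ ∣ S ∣
compressed-full {S = []}        _          = z≤n
compressed-full {S = true ∷ _}  compressed = s≤s (compressed-full (compressed-tail compressed))
compressed-full {S = false ∷ _} compressed with compressed zero
... | ()

∈compressed⇒≥ : ∀ {k j} {S : Subset (suc k)} → Compressed false S → j ∈ S → suc k ≤ toℕ j + ∣ S ∣
∈compressed⇒≥         {S = true ∷ _} compressed here       = s≤s (compressed-full compressed)
∈compressed⇒≥ {suc k} {S = x ∷ S}    compressed (there j∈) =
  s≤s (≤-trans (∈compressed⇒≥ (compressed-tail compressed) j∈) (+-monoʳ-≤ _ (∣p∣≤∣x∷p∣ x S)))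

initialSegment : ∀ m → ℕ → Subset m
initialSegment m κ = tabulate λ i → ⌊ toℕ i <? κ ⌋

finalSegment : ∀ m → ℕ → Subset m
finalSegment m t = tabulate λ i → ⌊ t ≤? toℕ i ⌋

⌊⌋-true : ∀ {A : Set} (a? : Dec A) → A → ⌊ a? ⌋ ≡ true
⌊⌋-true a? a = trans (isYes≗does a?) (dec-true a? a)

∈-tabulate⁺ : ∀ {m} {f : Fin m → Bool} {j} → f j ≡ true → j ∈ tabulate f
∈-tabulate⁺ {f = f} {j} fj = Vec.lookup⇒[]= j _ (trans (Vec.lookup∘tabulate f j) fj)

∈-initialSegment⁺ : ∀ {m κ} {j : Fin m} → toℕ j < κ → j ∈ initialSegment m κ
∈-initialSegment⁺ {κ = κ} {j} j<κ = ∈-tabulate⁺ (⌊⌋-true (toℕ j <? κ) j<κ)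

∈-finalSegment⁺ : ∀ {m t} {j : Fin m} → t ≤ toℕ j → j ∈ finalSegment m t
∈-finalSegment⁺ {t = t} {j} t≤j = ∈-tabulate⁺ (⌊⌋-true (t ≤? toℕ j) t≤j)

≤?-suc : ∀ a b → ⌊ suc a ≤? suc b ⌋ ≡ ⌊ a ≤? b ⌋
≤?-suc a b = begin
  ⌊ suc a ≤? suc b ⌋    ≡⟨ isYes≗does (suc a ≤? suc b) ⟩
  does (suc a ≤? suc b) ≡⟨ does-⇔ (mk⇔ s≤s⁻¹ s≤s) (suc a ≤? suc b) (a ≤? b) ⟩
  does (a ≤? b)         ≡⟨ isYes≗does (a ≤? b) ⟨
  ⌊ a ≤? b ⌋            ∎

∣initialSegment∣ : ∀ m κ → κ ≤ m → ∣ initialSegment m κ ∣ ≡ κ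
∣initialSegment∣ zero    zero    z≤n      = refl
∣initialSegment∣ (suc m) zero    z≤n      = ∣initialSegment∣ m zero z≤n
∣initialSegment∣ (suc m) (suc κ) (s≤s κ≤m) = cong suc (trans (cong ∣_∣ shift) (∣initialSegment∣ m κ κ≤m))
  where
  shift : tabulate (λ i → ⌊ suc (toℕ i) <? suc κ ⌋) ≡ initialSegment m κ
  shift = Vec.tabulate-cong λ i → ≤?-suc (suc (toℕ i)) κ

∣finalSegment∣ : ∀ m t → ∣ finalSegment m t ∣ ≡ m ∸ t
∣finalSegment∣ zero    zero    = refl
∣finalSegment∣ zero    (suc t) = refl
∣finalSegment∣ (suc m) zero    = cong suc (∣finalSegment∣ m zero)
∣finalSegment∣ (suc m) (suc t) = trans (cong ∣_∣ shift) (∣finalSegment∣ m t)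
  where
  shift : tabulate (λ i → ⌊ suc t ≤? suc (toℕ i) ⌋) ≡ finalSegment m t
  shift = Vec.tabulate-cong λ i → ≤?-suc t (toℕ i)

compressed⊆initialSegment : ∀ {k} {S : Subset (suc k)} → Compressed true S →
                            S ⊆ initialSegment (suc k) ∣ S ∣
compressed⊆initialSegment compressed j∈ = ∈-initialSegment⁺ (∈compressed⇒< compressed j∈)

compressed⊆finalSegment : ∀ {k} {S : Subset (suc k)} → Compressed false S →
                          S ⊆ finalSegment (suc k) (suc k ∸ ∣ S ∣)
compressed⊆finalSegment {k} {S} compressed {j} j∈ = ∈-finalSegment⁺
  (m≤n+o⇒m∸n≤o (suc k) ∣ S ∣ (subst (suc k ≤_) (+-comm (toℕ j) ∣ S ∣) (∈compressed⇒≥ compressed j∈)))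

∣L₀∣ : ∀ {n} m (side : Fin n → Bool) (κ : Fin n → ℕ) v → κ v ≤ m → ∣ L₀ m side κ v ∣ ≡ κ v
∣L₀∣ m side κ v κv≤m with side v
... | true  = ∣initialSegment∣ m (κ v) κv≤m
... | false = trans (∣finalSegment∣ m (m ∸ κ v)) (m∸[m∸n]≡n κv≤m)

compressed⊆L₀ : ∀ {n k} (side : Fin n → Bool) (κ : Fin n → ℕ) {L : ListAssignment n (suc k)} v →
                Compressed (side v) (L v) → ∣ L v ∣ ≡ κ v → L v ⊆ L₀ (suc k) side κ v
compressed⊆L₀ {k = k} side κ {L} v compressed ∣Lv∣≡κv with side v
... | true  = subst (λ t → L v ⊆ initialSegment (suc k) t) ∣Lv∣≡κv (compressed⊆initialSegment compressed)
... | false = subst (λ t → L v ⊆ finalSegment (suc k) (suc k ∸ t)) ∣Lv∣≡κv (compressed⊆finalSegment compressed)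

sum-mono-≤ : ∀ {n} {f g : Fin n → ℕ} → (∀ v → f v ≤ g v) → sum f ≤ sum g
sum-mono-≤ {zero}  _   = z≤n
sum-mono-≤ {suc n} f≤g = +-mono-≤ (f≤g zero) (sum-mono-≤ (f≤g ∘ suc))

sum-mono-< : ∀ {n} {f g : Fin n → ℕ} → (∀ v → f v ≤ g v) → ∀ v → f v < g v → sum f < sum g
sum-mono-< {suc n} f≤g zero    f<g = +-mono-<-≤ f<g (sum-mono-≤ (f≤g ∘ suc))
sum-mono-< {suc n} f≤g (suc v) f<g = +-mono-≤-< (f≤g zero) (sum-mono-< (f≤g ∘ suc) v f<g)

inject₁≢suc : ∀ {k} (i : Fin k) → inject₁ i ≢ suc i
inject₁≢suc i eq = 1+n≢n (sym (trans (sym (toℕ-inject₁ i)) (cong toℕ eq)))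

module _ {n k : ℕ} (E : Fin n → Fin n → Bool) (E-sym : ∀ u v → E u v ≡ E v u)
  (side : Fin n → Bool) (bipartite : ∀ u v → E u v ≡ true → side u ≢ side v) where

  _≟ˢ_ : (S T : Subset (suc k)) → Dec (S ≡ T)
  _≟ˢ_ = Vec.≡-dec _≟ᵇ_

  compressAt : Fin k → ListAssignment n (suc k) → ListAssignment n (suc k)
  compressAt i L v = compress (side v) i (L v)

  numColourings-compressAt : ∀ i L → numColourings E L ≤ numColourings E (compressAt i L)
  numColourings-compressAt i L = KempeRecolouring.numColourings-≤ E E-sym side bipartite (inject₁≢suc i)
    (λ v → compress-keeps-others (side v) i) (λ v → compress-keeps-target (side v) i)
    (λ v → compress-moves-source (side v) i) (λ v → compress-keeps-both (side v) i)

  totalDisplacement : ListAssignment n (suc k) → ℕ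
  totalDisplacement L = sum λ v → displacement (side v) (L v)

  totalDisplacement-compressAt : ∀ i L v → compressAt i L v ≢ L v →
                                 totalDisplacement (compressAt i L) < totalDisplacement L
  totalDisplacement-compressAt i L v moved = sum-mono-< ≤-at v <-at-v
    where
    ≤-at : ∀ u → displacement (side u) (compressAt i L u) ≤ displacement (side u) (L u)
    ≤-at u with compress-fixes-or-decreases (side u) i (L u)
    ... | inj₁ fixed   = ≤-reflexive (cong (displacement (side u)) fixed)
    ... | inj₂ smaller = <⇒≤ smaller
    <-at-v : displacement (side v) (compressAt i L v) < displacement (side v) (L v)
    <-at-v with compress-fixes-or-decreases (side v) i (L v)
    ... | inj₁ fixed   = contradiction fixed moved
    ... | inj₂ smaller = smaller

  compression-limit : ∀ L → Acc _<_ (totalDisplacement L) →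
    ∃ λ L* → (∀ v → Compressed (side v) (L* v)) × (∀ v → ∣ L* v ∣ ≡ ∣ L v ∣) ×
             numColourings E L ≤ numColourings E L*
  compression-limit L (acc smaller) with any? (λ v → any? (λ i → ¬? (compressAt i L v ≟ˢ L v)))
  ... | no  none = L , (λ v i → decidable-stable (_ ≟ˢ _) λ moved → none (v , i , moved)) , (λ _ → refl) , ≤-refl
  ... | yes (v , i , moved)
    with L* , compressed , ∣L*∣ , more ←
           compression-limit (compressAt i L) (smaller (totalDisplacement-compressAt i L v moved))
    = L* , compressed , (λ u → trans (∣L*∣ u) (∣compress∣ (side u) i (L u))) ,
      ≤-trans (numColourings-compressAt i L) more

L₀-maximal : ∀ {n m} (E : Fin n → Fin n → Bool) → (∀ u v → E u v ≡ E v u) →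
  (side : Fin n → Bool) → (∀ u v → E u v ≡ true → side u ≢ side v) →
  (κ : Fin n → ℕ) (L : ListAssignment n m) → (∀ v → ∣ L v ∣ ≡ κ v) →
  numColourings E L ≤ numColourings E (L₀ m side κ)
L₀-maximal {m = zero}  E _     _    _         _ _ _ = numColourings-mono E λ _ {j} → λ ()
L₀-maximal {m = suc k} E E-sym side bipartite κ L ∣L∣≡κ
  with L* , compressed , ∣L*∣≡∣L∣ , L≤L* ← compression-limit E E-sym side bipartite L (<-wellFounded _)
  = ≤-trans L≤L* (numColourings-mono E λ v →
      compressed⊆L₀ side κ {L*} v (compressed v) (trans (∣L*∣≡∣L∣ v) (∣L∣≡κ v)))

corollary3p2 :
    (n m : ℕ) (E : Fin n → Fin n → Bool) →
    (∀ u v → E u v ≡ E v u) → (∀ v → E v v ≡ false) →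
    (side : Fin n → Bool) → (∀ u v → E u v ≡ true → ¬ (side u ≡ side v)) →
    (κ : Fin n → ℕ) → (∀ v → 1 ≤ κ v) → (∀ v → κ v ≤ m) →
    ((∀ v → ∣ L₀ m side κ v ∣ ≡ κ v) ×
     ((L : ListAssignment n m) → (∀ v → ∣ L v ∣ ≡ κ v) →
        numColourings E L ≤ numColourings E (L₀ m side κ)))
corollary3p2 n m E E-sym _ side bipartite κ _ κ≤m =
  (λ v → ∣L₀∣ m side κ v (κ≤m v)) , L₀-maximal E E-sym side bipartite κ
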